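{- Let $k\ge1$, let $G=(V,E)$ be a finite $(k+1)$-claw free graph with positive vertex weights $w$, let $O$ be a maximum-weight independent set and $A$ an independent set of $G$ with $N(o,A)\neq\emptyset$ for all $o\in O$. Suppose $A$ is locally optimal with respect to 1-exchanges. Let $0\le\delta\le\epsilon<1$ and for $0\le t\le k$ define $\rho_t=\frac{t(\epsilon-\delta)}{1-\delta}-\frac{\epsilon-\delta}{1-\epsilon}$. Then for any isolated vertex $a$ of $H_\epsilon$, $$\frac{\Psi_a}{w_a}\ge\rho_{|C_a|}\,w_a+\delta\sum_{o\in C_a}w(N(o,A-a)).$$
   Context: $(k+1)$-claw free: no induced subgraph consisting of a vertex adjacent to $k+1$ pairwise non-adjacent vertices. $w(X)=\sum_{v\in X}w_v$, $w^2(X)=\sum_{v\in X}w_v^2$. For $X,Y\subseteq V$, $N(X,Y)=\{y\in Y: y\text{ adjacent to some }x\in X\}\cup(X\cap Y)$, $N(v,Y)=N(\{v\},Y)$, $A-a=A\setminus\{a\}$. For $o\in O$, $\pi(o)$ is a vertex of $N(o,A)$ of maximum weight (ties broken arbitrarily but consistently). For $a\in A$: $C_a=\{o\in O:\pi(o)=a\}$, $N^+_a=\{a\}\cup\bigcup_{o\in C_a}N(o,A-a)$, $\psi_{a,o}=(w_o-w_a)^2+w_a\,w(N(o,A-a))-w^2(N(o,A-a))$, $\Psi_a=\sum_{o\in C_a}\psi_{a,o}$. $A$ is locally optimal with respect to 1-exchanges if $w^2(C_a)\le w^2(N^+_a)$ for every $a\in A$. The exchange graph $H_\epsilon$ ($0\le\epsilon\le1$)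 is the directed graph with vertex set $A$ having an arc $(a,b)$, $a\neq b$, iff $a\in N^+_b$ and $w_a\ge(1-\epsilon)w_b$; a vertex is isolated if it is incident to no arc.
   Formalization: The vertex weights $w$ and the parameters ε and δ take rational values. -}

module Defs where

open import Data.Nat using (ℕ; zero; suc)
open import Data.Fin using (Fin; zero; suc)
open import Data.Fin.Properties using () renaming (_≟_ to _≟ᶠ_)
open import Data.Bool using (Bool; true; false; _∧_; _∨_; not; if_then_else_)
open import Data.Integer using (+_)
open import Data.Rational using (ℚ; 0ℚ; 1ℚ; _+_; _*_; _-_; -_; _≤_; _<_; _÷_; >-nonZero)
open import Data.Rational.Properties using (+-monoˡ-<; +-inverseʳ)
open import Data.Product using (Σ; _×_; _,_)
open import Relation.Nullary using (¬_; does)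
open import Relation.Binary.PropositionalEquality using (_≡_; _≢_; subst)

record Graph (n : ℕ) : Set where
  field
    adj    : Fin n → Fin n → Bool
    sym    : ∀ u v → adj u v ≡ adj v u
    irrefl : ∀ v → adj v v ≡ false
open Graph public

VSet : ℕ → Set
VSet n = Fin n → Bool

anyFin : ∀ {n} → (Fin n → Bool) → Bool
anyFin {zero}  f = false
anyFin {suc n} f = f zero ∨ anyFin (λ i → f (suc i))

sumFin : ∀ {n} → (Fin n → ℚ) → ℚ
sumFin {zero}  f = 0ℚ
sumFin {suc n} f = f zero + sumFin (λ i → f (suc i))

card : ∀ {n} → VSet n → ℕ
card {zero}  X = zero
card {suc n} X = (if X zero then 1 else 0) Data.Nat.+ card (λ i → X (suc i))

eqᵇ : ∀ {n} → Fin n → Fin n → Bool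
eqᵇ u v = does (u ≟ᶠ v)

_─_ : ∀ {n} → VSet n → Fin n → VSet n
(A ─ a) v = A v ∧ not (eqᵇ v a)

⟦_⟧ : ∀ {n} → Fin n → VSet n
⟦ a ⟧ v = eqᵇ v a

_∈_ : ∀ {n} → Fin n → VSet n → Set
v ∈ X = X v ≡ true

Independent : ∀ {n} → Graph n → VSet n → Set
Independent G S = ∀ u v → u ∈ S → v ∈ S → adj G u v ≡ false

ClawFree : ∀ {n} → ℕ → Graph n → Set
ClawFree {n} k G =
  ¬ (Σ (Fin n) λ c → Σ (Fin (suc k) → Fin n) λ f →
       (∀ i → adj G c (f i) ≡ true) ×
       (∀ i j → i ≢ j → f i ≢ f j) ×
       (∀ i j → adj G (f i) (f j) ≡ false))

w[_] : ∀ {n} → (Fin n → ℚ) → VSet n → ℚ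
w[ w ] X = sumFin λ v → if X v then w v else 0ℚ

w²[_] : ∀ {n} → (Fin n → ℚ) → VSet n → ℚ
w²[ w ] X = sumFin λ v → if X v then w v * w v else 0ℚ

MaxWeightIndependent : ∀ {n} → Graph n → (Fin n → ℚ) → VSet n → Set
MaxWeightIndependent G w O =
  Independent G O × (∀ S → Independent G S → w[ w ] S ≤ w[ w ] O)

-- N(X,Y) = {y ∈ Y : y adjacent to some x ∈ X} ∪ (X ∩ Y)
Nb : ∀ {n} → Graph n → VSet n → VSet n → VSet n
Nb G X Y y = Y y ∧ (X y ∨ anyFin (λ x → X x ∧ adj G x y))

Nv : ∀ {n} → Graph n → Fin n → VSet n → VSet n
Nv G v Y = Nb G ⟦ v ⟧ Y

-- π is a valid choice: for o ∈ O, π(o) is a max-weight vertex of N(o,A)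
-- (a function, hence ties are broken consistently)
IsPi : ∀ {n} → Graph n → (Fin n → ℚ) → VSet n → VSet n → (Fin n → Fin n) → Set
IsPi G w O A π = ∀ o → o ∈ O →
  (π o ∈ Nv G o A) × (∀ a → a ∈ Nv G o A → w a ≤ w (π o))

module Exchange {n : ℕ} (G : Graph n) (w : Fin n → ℚ) (O A : VSet n)
                (π : Fin n → Fin n) where

  C : Fin n → VSet n
  C a o = O o ∧ eqᵇ (π o) a

  N⁺ : Fin n → VSet n
  N⁺ a v = eqᵇ v a ∨ anyFin (λ o → C a o ∧ Nv G o (A ─ a) v)

  ψ : Fin n → Fin n → ℚ
  ψ a o = (w o - w a) * (w o - w a)
          + w a * w[ w ] (Nv G o (A ─ a)) - w²[ w ] (Nv G o (A ─ a))

  Ψ : Fin n → ℚ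
  Ψ a = sumFin λ o → if C a o then ψ a o else 0ℚ

  LocallyOptimal : Set
  LocallyOptimal = ∀ a → a ∈ A → w²[ w ] (C a) ≤ w²[ w ] (N⁺ a)

  Arc : ℚ → Fin n → Fin n → Set
  Arc ε a b = a ∈ A × b ∈ A × a ≢ b × a ∈ N⁺ b × (1ℚ - ε) * w b ≤ w a

  IsolatedIn-H : ℚ → Fin n → Set
  IsolatedIn-H ε a = a ∈ A × (∀ b → ¬ Arc ε a b) × (∀ b → ¬ Arc ε b a)

ℕ→ℚ : ℕ → ℚ
ℕ→ℚ t = + t Data.Rational./ 1

0<1-x : ∀ {x} → x < 1ℚ → 0ℚ < 1ℚ - x
0<1-x {x} x<1 = subst (_< 1ℚ - x) (+-inverseʳ x) (+-monoˡ-< (- x) x<1)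

ρ : (ε δ : ℚ) → ε < 1ℚ → δ < 1ℚ → ℕ → ℚ
ρ ε δ ε<1 δ<1 t =
  _÷_ (ℕ→ℚ t * (ε - δ)) (1ℚ - δ) {{>-nonZero (0<1-x δ<1)}}
  - _÷_ (ε - δ) (1ℚ - ε) {{>-nonZero (0<1-x ε<1)}}

{-# OPTIONS --safe #-}
module Submission where

-- Write W = w_a, d = 1 − δ, e = 1 − ε and S = Σ_{o ∈ C_a} w(N(o, A − a)).
-- As a has no incoming arc in H_ε, every v ∈ N(o, A − a) with o ∈ C_a weighs less
-- than eW. Hence w²(N(o, A − a)) ≤ eW · w(N(o, A − a)), which gives
-- Ψ_a ≥ Σ_{o ∈ C_a} (w_o − W)² + εW·S, and, with local optimality,
-- w²(C_a) ≤ w²(N⁺_a) ≤ W² + eW·S.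
-- Expanding (d w_o − eW)² ≥ 0 yields P W² ≤ (w_o − W)² + Q w_o², where
-- P = (ε − δ)/d and Q = (ε − δ)/e, so that ρ_t = tP − Q. Summing over C_a, bounding
-- w²(C_a) as above and using Qe = ε − δ gives W (ρ_{|C_a|} W + δ S) ≤ Ψ_a.

open import Data.Nat using (ℕ; _≥_; zero; suc)
open import Data.Fin using (Fin; zero; suc)
open import Data.Fin.Properties using () renaming (_≟_ to _≟ᶠ_)
open import Data.Bool using (Bool; true; false; if_then_else_; _∧_; _∨_; not)
open import Data.Bool.Properties using (∨-zeroʳ; ∧-conicalˡ; ∧-conicalʳ)
import Data.Integer as ℤ
import Data.Integer.Tactic.RingSolver as ℤ
open import Data.Rational
  using (ℚ; 0ℚ; 1ℚ; _+_; _*_; _-_; -_; _≤_; _<_; _÷_; 1/_; >-nonZero; NonZero; Positive; positive; nonNegative; nonPositive)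
open import Data.Rational.Properties
import Data.Rational.Unnormalised as ℚᵘ
import Data.Rational.Unnormalised.Properties as ℚᵘ
open import Data.Product using (Σ; ∃; _,_; proj₁; proj₂)
open import Data.Sum using (inj₁; inj₂)
open import Level using (0ℓ)
open import Relation.Nullary using (yes; no; contradiction)
open import Relation.Nullary.Decidable using (dec-true)
open import Relation.Nullary.Decidable.Core using (dec⇒maybe)
open import Relation.Binary.PropositionalEquality
open import Function using (case_of_)
import Tactic.RingSolver.Core.AlmostCommutativeRing as ACR
open import Tactic.RingSolver using (solve-∀)

open import Defs hiding (sym)

open ≤-Reasoning

ℚ-ring : ACR.AlmostCommutativeRing 0ℓ 0ℓ
ℚ-ring = ACR.fromCommutativeRing +-*-commutativeRing λ p → dec⇒maybe (0ℚ ≟ p)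

ℕ→ℚ-suc : ∀ m → ℕ→ℚ (suc m) ≡ 1ℚ + ℕ→ℚ m
ℕ→ℚ-suc m = toℚᵘ-injective (ℚᵘ.≃-trans (toℚᵘ-fromℚᵘ (ℚᵘ.mkℚᵘ (ℤ.+ suc m) 0))
  (ℚᵘ.≃-sym (ℚᵘ.≃-trans (toℚᵘ-homo-+ 1ℚ (ℕ→ℚ m))
    (ℚᵘ.≃-trans (ℚᵘ.+-congʳ ℚᵘ.1ℚᵘ (toℚᵘ-fromℚᵘ (ℚᵘ.mkℚᵘ (ℤ.+ m) 0)))
      (ℚᵘ.*≡* (one-plus (ℤ.+ m)))))))
  where
  one-plus : ∀ i → (ℤ.1ℤ ℤ.* ℤ.1ℤ ℤ.+ i ℤ.* ℤ.1ℤ) ℤ.* ℤ.1ℤ ≡ (ℤ.1ℤ ℤ.+ i) ℤ.* (ℤ.1ℤ ℤ.* ℤ.1ℤ)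
  one-plus = ℤ.solve-∀

x*x-nonNeg : ∀ x → 0ℚ ≤ x * x
x*x-nonNeg x with ≤-total 0ℚ x
... | inj₁ 0≤x = subst (_≤ x * x) (*-zeroˡ x) (*-monoʳ-≤-nonNeg x {{nonNegative 0≤x}} 0≤x)
... | inj₂ x≤0 = subst (_≤ x * x) (*-zeroˡ x) (*-monoʳ-≤-nonPos x {{nonPositive x≤0}} x≤0)

p≤p+q : ∀ p {q} → 0ℚ ≤ q → p ≤ p + q
p≤p+q p {q} 0≤q = begin
  p      ≡⟨ +-identityʳ p ⟨
  p + 0ℚ ≤⟨ +-monoʳ-≤ p 0≤q ⟩
  p + q  ∎

÷-*-cancel : ∀ p q .{{_ : NonZero q}} → (p ÷ q) * q ≡ p
÷-*-cancel p q = begin-equality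
  p * 1/ q * q   ≡⟨ *-assoc p (1/ q) q ⟩
  p * (1/ q * q) ≡⟨ cong (p *_) (*-inverseˡ q) ⟩
  p * 1ℚ         ≡⟨ *-identityʳ p ⟩
  p              ∎

*≤⇒≤÷ : ∀ {p q r} (0<r : 0ℚ < r) → r * p ≤ q → p ≤ _÷_ q r {{>-nonZero 0<r}}
*≤⇒≤÷ {p} {q} {r} 0<r rp≤q = *-cancelʳ-≤-pos r (begin
  p * r     ≡⟨ *-comm p r ⟩
  r * p     ≤⟨ rp≤q ⟩
  q         ≡⟨ ÷-*-cancel q r ⟨
  q ÷ r * r ∎)
  where
  instance
    r≢0 : NonZero r
    r≢0 = >-nonZero 0<r
    r>0 : Positive r
    r>0 = positive 0<r

square-bound : ∀ {d e P Q} → 0ℚ < d → 0ℚ < e → P * d ≡ d - e → Q * e ≡ d - e →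
               ∀ x W → P * (W * W) ≤ (x - W) * (x - W) + Q * (x * x)
square-bound {d} {e} {P} {Q} 0<d 0<e Pd≡d-e Qe≡d-e x W =
  let instance _ = pos*pos⇒pos d {{positive 0<d}} e {{positive 0<e}} in
  *-cancelˡ-≤-pos (d * e) (begin
    d * e * (P * (W * W))                         ≡⟨ regroupˡ d e P W ⟩
    e * (P * d) * (W * W)                         ≡⟨ cong (λ z → e * z * (W * W)) Pd≡d-e ⟩
    e * (d - e) * (W * W)                         ≤⟨ p≤p+q _ (x*x-nonNeg (d * x - e * W)) ⟩
    e * (d - e) * (W * W) + (d * x - e * W) * (d * x - e * W)
                                                  ≡⟨ complete-square d e x W ⟩
    d * e * ((x - W) * (x - W)) + d * (d - e) * (x * x)
                                                  ≡⟨ cong (λ z → d * e * ((x - W) * (x - W)) + d * z * (x * x)) Qe≡d-e ⟨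
    d * e * ((x - W) * (x - W)) + d * (Q * e) * (x * x)
                                                  ≡⟨ regroupʳ d e Q x W ⟩
    d * e * ((x - W) * (x - W) + Q * (x * x))     ∎)
  where
  regroupˡ : ∀ d e P W → d * e * (P * (W * W)) ≡ e * (P * d) * (W * W)
  regroupˡ = solve-∀ ℚ-ring
  complete-square : ∀ d e x W →
    e * (d - e) * (W * W) + (d * x - e * W) * (d * x - e * W)
      ≡ d * e * ((x - W) * (x - W)) + d * (d - e) * (x * x)
  complete-square = solve-∀ ℚ-ring
  regroupʳ : ∀ d e Q x W →
    d * e * ((x - W) * (x - W)) + d * (Q * e) * (x * x) ≡ d * e * ((x - W) * (x - W) + Q * (x * x))
  regroupʳ = solve-∀ ℚ-ring

sumFin-cong : ∀ {n} {f g : Fin n → ℚ} → (∀ i → f i ≡ g i) → sumFin f ≡ sumFin g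
sumFin-cong {zero}  f≡g = refl
sumFin-cong {suc n} f≡g = cong₂ _+_ (f≡g zero) (sumFin-cong (λ i → f≡g (suc i)))

sumFin-mono : ∀ {n} {f g : Fin n → ℚ} → (∀ i → f i ≤ g i) → sumFin f ≤ sumFin g
sumFin-mono {zero}  f≤g = ≤-refl
sumFin-mono {suc n} f≤g = +-mono-≤ (f≤g zero) (sumFin-mono (λ i → f≤g (suc i)))

sumFin-0 : ∀ n → sumFin {n} (λ _ → 0ℚ) ≡ 0ℚ
sumFin-0 zero    = refl
sumFin-0 (suc n) = trans (cong (0ℚ +_) (sumFin-0 n)) (+-identityʳ 0ℚ)

sumFin-+ : ∀ {n} (f g : Fin n → ℚ) → sumFin (λ i → f i + g i) ≡ sumFin f + sumFin g
sumFin-+ {zero}  f g = sym (+-identityʳ 0ℚ)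
sumFin-+ {suc n} f g = begin-equality
  f zero + g zero + sumFin (λ i → f (suc i) + g (suc i))
    ≡⟨ cong (f zero + g zero +_) (sumFin-+ (λ i → f (suc i)) (λ i → g (suc i))) ⟩
  f zero + g zero + (sumFin (λ i → f (suc i)) + sumFin (λ i → g (suc i)))
    ≡⟨ interchange (f zero) (g zero) _ _ ⟩
  f zero + sumFin (λ i → f (suc i)) + (g zero + sumFin (λ i → g (suc i))) ∎
  where
  interchange : ∀ a b c d → a + b + (c + d) ≡ a + c + (b + d)
  interchange = solve-∀ ℚ-ring

sumFin-*ˡ : ∀ {n} c (f : Fin n → ℚ) → sumFin (λ i → c * f i) ≡ c * sumFin f
sumFin-*ˡ {zero}  c f = sym (*-zeroʳ c)
sumFin-*ˡ {suc n} c f =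
  trans (cong (c * f zero +_) (sumFin-*ˡ c (λ i → f (suc i)))) (sym (*-distribˡ-+ c _ _))

sumFin-nonNeg : ∀ {n} {f : Fin n → ℚ} → (∀ i → 0ℚ ≤ f i) → 0ℚ ≤ sumFin f
sumFin-nonNeg {n} {f} 0≤f = subst (_≤ sumFin f) (sumFin-0 n) (sumFin-mono 0≤f)

≤sumFin : ∀ {n} {f : Fin n → ℚ} → (∀ i → 0ℚ ≤ f i) → ∀ j → f j ≤ sumFin f
≤sumFin {suc n} {f} 0≤f zero    = p≤p+q (f zero) (sumFin-nonNeg (λ i → 0≤f (suc i)))
≤sumFin {suc n} {f} 0≤f (suc j) = begin
  f (suc j)                          ≤⟨ ≤sumFin (λ i → 0≤f (suc i)) j ⟩
  sumFin (λ i → f (suc i))           ≤⟨ p≤p+q _ (0≤f zero) ⟩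
  sumFin (λ i → f (suc i)) + f zero  ≡⟨ +-comm _ (f zero) ⟩
  sumFin f                           ∎

sumFin-comm : ∀ {m n} (f : Fin m → Fin n → ℚ) →
              sumFin (λ i → sumFin (f i)) ≡ sumFin (λ j → sumFin (λ i → f i j))
sumFin-comm {zero}  {n} f = sym (sumFin-0 n)
sumFin-comm {suc m} {n} f = begin-equality
  sumFin (f zero) + sumFin (λ i → sumFin (f (suc i)))
    ≡⟨ cong (sumFin (f zero) +_) (sumFin-comm (λ i → f (suc i))) ⟩
  sumFin (f zero) + sumFin (λ j → sumFin (λ i → f (suc i) j))
    ≡⟨ sumFin-+ (f zero) _ ⟨
  sumFin (λ j → sumFin (λ i → f i j)) ∎

-- w[ w ] X and w²[ w ] X unfold to sumOver X w and sumOver X (λ v → w v * w v).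
sumOver : ∀ {n} → VSet n → (Fin n → ℚ) → ℚ
sumOver X f = sumFin λ v → if X v then f v else 0ℚ

sumOver-⟦⟧ : ∀ {n} (a : Fin n) f → sumOver ⟦ a ⟧ f ≡ f a
sumOver-⟦⟧ {suc n} zero    f = trans (cong (f zero +_) (sumFin-0 n)) (+-identityʳ (f zero))
sumOver-⟦⟧ {suc n} (suc a) f = trans (+-identityˡ _) (sumOver-⟦⟧ a (λ i → f (suc i)))

card*≡sumOver : ∀ {n} (X : VSet n) c → ℕ→ℚ (card X) * c ≡ sumOver X (λ _ → c)
card*≡sumOver {zero}  X c = *-zeroˡ c
card*≡sumOver {suc n} X c with X zero
... | true  = begin-equality
  ℕ→ℚ (suc (card X′)) * c     ≡⟨ cong (_* c) (ℕ→ℚ-suc (card X′)) ⟩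
  (1ℚ + ℕ→ℚ (card X′)) * c    ≡⟨ *-distribʳ-+ c 1ℚ (ℕ→ℚ (card X′)) ⟩
  1ℚ * c + ℕ→ℚ (card X′) * c  ≡⟨ cong₂ _+_ (*-identityˡ c) (card*≡sumOver X′ c) ⟩
  c + sumOver X′ (λ _ → c)    ∎
  where
  X′ : VSet n
  X′ i = X (suc i)
... | false = trans (card*≡sumOver (λ i → X (suc i)) c) (sym (+-identityˡ _))

if-nonNeg : ∀ b {x} → 0ℚ ≤ x → 0ℚ ≤ (if b then x else 0ℚ)
if-nonNeg true  0≤x = 0≤x
if-nonNeg false 0≤x = ≤-refl

module _ {n : ℕ} where

  sumOver-nonNeg : ∀ (X : VSet n) {f} → (∀ v → 0ℚ ≤ f v) → 0ℚ ≤ sumOver X f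
  sumOver-nonNeg X 0≤f = sumFin-nonNeg (λ v → if-nonNeg (X v) (0≤f v))

  ≤sumOver : ∀ (X : VSet n) {f} → (∀ v → 0ℚ ≤ f v) → ∀ {v} → v ∈ X → f v ≤ sumOver X f
  ≤sumOver X {f} 0≤f {v} v∈X = begin
    f v                        ≡⟨ cong (λ b → if b then f v else 0ℚ) v∈X ⟨
    (if X v then f v else 0ℚ)  ≤⟨ ≤sumFin (λ u → if-nonNeg (X u) (0≤f u)) v ⟩
    sumOver X f                ∎

  sumOver-mono : ∀ (X : VSet n) {f g} → (∀ {v} → v ∈ X → f v ≤ g v) → sumOver X f ≤ sumOver X g
  sumOver-mono X {f} {g} f≤g = sumFin-mono term-mono
    where
    term-mono : ∀ v → (if X v then f v else 0ℚ) ≤ (if X v then g v else 0ℚ)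
    term-mono v with X v in v∈X
    ... | true  = f≤g v∈X
    ... | false = ≤-refl

  sumOver-+ : ∀ (X : VSet n) f g → sumOver X (λ v → f v + g v) ≡ sumOver X f + sumOver X g
  sumOver-+ X f g =
    trans (sumFin-cong split) (sumFin-+ (λ v → if X v then f v else 0ℚ) (λ v → if X v then g v else 0ℚ))
    where
    split : ∀ v → (if X v then f v + g v else 0ℚ)
                ≡ (if X v then f v else 0ℚ) + (if X v then g v else 0ℚ)
    split v with X v
    ... | true  = refl
    ... | false = sym (+-identityʳ 0ℚ)

  sumOver-*ˡ : ∀ (X : VSet n) c f → sumOver X (λ v → c * f v) ≡ c * sumOver X f
  sumOver-*ˡ X c f = trans (sumFin-cong pull) (sumFin-*ˡ c (λ v → if X v then f v else 0ℚ))
    where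
    pull : ∀ v → (if X v then c * f v else 0ℚ) ≡ c * (if X v then f v else 0ℚ)
    pull v with X v
    ... | true  = refl
    ... | false = sym (*-zeroʳ c)

  sumOver-∪ : ∀ (X Y : VSet n) {f} → (∀ v → 0ℚ ≤ f v) →
              sumOver (λ v → X v ∨ Y v) f ≤ sumOver X f + sumOver Y f
  sumOver-∪ X Y {f} 0≤f = begin
    sumOver (λ v → X v ∨ Y v) f  ≤⟨ sumFin-mono term-bound ⟩
    sumFin (λ v → (if X v then f v else 0ℚ) + (if Y v then f v else 0ℚ))
                                 ≡⟨ sumFin-+ (λ v → if X v then f v else 0ℚ) (λ v → if Y v then f v else 0ℚ) ⟩
    sumOver X f + sumOver Y f    ∎
    where
    term-bound : ∀ v → (if X v ∨ Y v then f v else 0ℚ)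
                     ≤ (if X v then f v else 0ℚ) + (if Y v then f v else 0ℚ)
    term-bound v with X v
    ... | true  = p≤p+q (f v) (if-nonNeg (Y v) (0≤f v))
    ... | false = ≤-reflexive (sym (+-identityˡ _))

anyFin⇒∃ : ∀ {n} (f : Fin n → Bool) → anyFin f ≡ true → ∃ λ i → f i ≡ true
anyFin⇒∃ {suc n} f any-f with f zero in f0
... | true  = zero , f0
... | false = let i , fi = anyFin⇒∃ (λ i → f (suc i)) any-f in suc i , fi

∃⇒anyFin : ∀ {n} (f : Fin n → Bool) {i} → f i ≡ true → anyFin f ≡ true
∃⇒anyFin {suc n} f {zero}  fi rewrite fi = refl
∃⇒anyFin {suc n} f {suc i} fi = trans (cong (f zero ∨_) (∃⇒anyFin (λ j → f (suc j)) fi)) (∨-zeroʳ (f zero))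

∧-true : ∀ {x y} → x ≡ true → y ≡ true → x ∧ y ≡ true
∧-true refl refl = refl

not-eqᵇ⇒≢ : ∀ {n} {u v : Fin n} → not (eqᵇ u v) ≡ true → u ≢ v
not-eqᵇ⇒≢ {u = u} u≠u refl = case trans (sym u≠u) (cong not (dec-true (u ≟ᶠ u) refl)) of λ ()

sumOver-⋃ : ∀ {m n} (I : VSet m) (N : Fin m → VSet n) {f} → (∀ v → 0ℚ ≤ f v) →
            sumOver (λ v → anyFin (λ i → I i ∧ N i v)) f ≤ sumOver I (λ i → sumOver (N i) f)
sumOver-⋃ {n = n} I N {f} 0≤f = begin
  sumOver (λ v → anyFin (λ i → I i ∧ N i v)) f
    ≤⟨ sumFin-mono term-bound ⟩
  sumFin (λ v → sumOver (λ i → I i ∧ N i v) (λ _ → f v))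
    ≡⟨ sumFin-comm (λ v i → if I i ∧ N i v then f v else 0ℚ) ⟩
  sumFin (λ i → sumFin (λ v → if I i ∧ N i v then f v else 0ℚ))
    ≡⟨ sumFin-cong restrict ⟩
  sumOver I (λ i → sumOver (N i) f) ∎
  where
  term-bound : ∀ v → (if anyFin (λ i → I i ∧ N i v) then f v else 0ℚ)
                   ≤ sumOver (λ i → I i ∧ N i v) (λ _ → f v)
  term-bound v with anyFin (λ i → I i ∧ N i v) in covered
  ... | true  = ≤sumOver (λ i → I i ∧ N i v) (λ _ → 0≤f v) (proj₂ (anyFin⇒∃ (λ i → I i ∧ N i v) covered))
  ... | false = sumOver-nonNeg (λ i → I i ∧ N i v) (λ _ → 0≤f v)
  restrict : ∀ i → sumFin (λ v → if I i ∧ N i v then f v else 0ℚ)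
                 ≡ (if I i then sumOver (N i) f else 0ℚ)
  restrict i with I i
  ... | true  = refl
  ... | false = sumFin-0 n

w²≤*w : ∀ {n} (w : Fin n → ℚ) (X : VSet n) {c} → (∀ v → 0ℚ ≤ w v) →
        (∀ {v} → v ∈ X → w v ≤ c) → w²[ w ] X ≤ c * w[ w ] X
w²≤*w w X {c} 0≤w w≤c = begin
  w²[ w ] X                  ≤⟨ sumOver-mono X (λ {v} v∈X → *-monoʳ-≤-nonNeg (w v) {{nonNegative (0≤w v)}} (w≤c v∈X)) ⟩
  sumOver X (λ v → c * w v)  ≡⟨ sumOver-*ˡ X c w ⟩
  c * w[ w ] X               ∎

sumOver-square-bound : ∀ {n d e P Q} → 0ℚ < d → 0ℚ < e → P * d ≡ d - e → Q * e ≡ d - e →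
  ∀ (X : VSet n) (f : Fin n → ℚ) W →
  ℕ→ℚ (card X) * (P * (W * W))
    ≤ sumOver X (λ v → (f v - W) * (f v - W)) + Q * sumOver X (λ v → f v * f v)
sumOver-square-bound {P = P} {Q} 0<d 0<e Pd≡d-e Qe≡d-e X f W = begin
  ℕ→ℚ (card X) * (P * (W * W))
    ≡⟨ card*≡sumOver X (P * (W * W)) ⟩
  sumOver X (λ _ → P * (W * W))
    ≤⟨ sumOver-mono X (λ {v} _ → square-bound {P = P} {Q = Q} 0<d 0<e Pd≡d-e Qe≡d-e (f v) W) ⟩
  sumOver X (λ v → sq v + Q * (f v * f v))
    ≡⟨ sumOver-+ X sq (λ v → Q * (f v * f v)) ⟩
  sumOver X sq + sumOver X (λ v → Q * (f v * f v))
    ≡⟨ cong (sumOver X sq +_) (sumOver-*ˡ X Q (λ v → f v * f v)) ⟩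
  sumOver X sq + Q * sumOver X (λ v → f v * f v) ∎
  where
  sq : Fin _ → ℚ
  sq v = (f v - W) * (f v - W)

module Isolated {n} (G : Graph n) (w : Fin n → ℚ) (0≤w : ∀ v → 0ℚ ≤ w v) (O A : VSet n)
  (π : Fin n → Fin n) (ε : ℚ) (a : Fin n) (isolated : Exchange.IsolatedIn-H G w O A π ε a) where

  open Exchange G w O A π

  Nₐ : Fin n → VSet n
  Nₐ o = Nv G o (A ─ a)

  S : ℚ
  S = sumOver (C a) (λ o → w[ w ] (Nₐ o))

  light-neighbour : ∀ {o v} → o ∈ C a → v ∈ Nₐ o → w v < (1ℚ - ε) * w a
  light-neighbour {o} {v} o∈Cₐ v∈Nₐ with (1ℚ - ε) * w a ≤? w v
  ... | no  light = ≰⇒> light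
  ... | yes heavy = contradiction (v∈A , proj₁ isolated , v≢a , v∈N⁺ , heavy) (proj₂ (proj₂ isolated) v)
    where
    v∈A─a : v ∈ (A ─ a)
    v∈A─a = ∧-conicalˡ _ _ v∈Nₐ
    v∈A : v ∈ A
    v∈A = ∧-conicalˡ _ _ v∈A─a
    v≢a : v ≢ a
    v≢a = not-eqᵇ⇒≢ (∧-conicalʳ (A v) _ v∈A─a)
    v∈N⁺ : v ∈ N⁺ a
    v∈N⁺ = trans (cong (eqᵇ v a ∨_) (∃⇒anyFin (λ o → C a o ∧ Nₐ o v) (∧-true o∈Cₐ v∈Nₐ))) (∨-zeroʳ _)

  w²Nₐ≤ : ∀ {o} → o ∈ C a → w²[ w ] (Nₐ o) ≤ (1ℚ - ε) * w a * w[ w ] (Nₐ o)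
  w²Nₐ≤ {o} o∈Cₐ = w²≤*w w (Nₐ o) 0≤w (λ v∈Nₐ → <⇒≤ (light-neighbour o∈Cₐ v∈Nₐ))

  w²N⁺≤ : w²[ w ] (N⁺ a) ≤ w a * w a + (1ℚ - ε) * w a * S
  w²N⁺≤ = begin
    w²[ w ] (N⁺ a)
      ≤⟨ sumOver-∪ ⟦ a ⟧ (λ v → anyFin (λ o → C a o ∧ Nₐ o v)) 0≤w² ⟩
    sumOver ⟦ a ⟧ w² + sumOver (λ v → anyFin (λ o → C a o ∧ Nₐ o v)) w²
      ≤⟨ +-mono-≤ (≤-reflexive (sumOver-⟦⟧ a w²)) (sumOver-⋃ (C a) Nₐ 0≤w²) ⟩
    w a * w a + sumOver (C a) (λ o → w²[ w ] (Nₐ o))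
      ≤⟨ +-monoʳ-≤ (w a * w a) (sumOver-mono (C a) w²Nₐ≤) ⟩
    w a * w a + sumOver (C a) (λ o → (1ℚ - ε) * w a * w[ w ] (Nₐ o))
      ≡⟨ cong (w a * w a +_) (sumOver-*ˡ (C a) ((1ℚ - ε) * w a) (λ o → w[ w ] (Nₐ o))) ⟩
    w a * w a + (1ℚ - ε) * w a * S ∎
    where
    w² : Fin n → ℚ
    w² v = w v * w v
    0≤w² : ∀ v → 0ℚ ≤ w² v
    0≤w² v = x*x-nonNeg (w v)

  ψ-lower-bound : ∀ {o} → o ∈ C a → (w o - w a) * (w o - w a) + ε * w a * w[ w ] (Nₐ o) ≤ ψ a o
  ψ-lower-bound {o} o∈Cₐ = begin
    sq + ε * w a * nw                       ≡⟨ rearrange sq (w a) nw ε ⟩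
    sq + w a * nw - (1ℚ - ε) * w a * nw     ≤⟨ +-monoʳ-≤ (sq + w a * nw) (neg-antimono-≤ (w²Nₐ≤ o∈Cₐ)) ⟩
    sq + w a * nw - w²[ w ] (Nₐ o)          ∎
    where
    sq nw : ℚ
    sq = (w o - w a) * (w o - w a)
    nw = w[ w ] (Nₐ o)
    rearrange : ∀ s W x ε → s + ε * W * x ≡ s + W * x - (1ℚ - ε) * W * x
    rearrange = solve-∀ ℚ-ring

  Ψ-lower-bound : sumOver (C a) (λ o → (w o - w a) * (w o - w a)) + ε * w a * S ≤ Ψ a
  Ψ-lower-bound = begin
    sumOver (C a) sq + ε * w a * S
      ≡⟨ cong (sumOver (C a) sq +_) (sumOver-*ˡ (C a) (ε * w a) (λ o → w[ w ] (Nₐ o))) ⟨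
    sumOver (C a) sq + sumOver (C a) (λ o → ε * w a * w[ w ] (Nₐ o))
      ≡⟨ sumOver-+ (C a) sq (λ o → ε * w a * w[ w ] (Nₐ o)) ⟨
    sumOver (C a) (λ o → sq o + ε * w a * w[ w ] (Nₐ o))
      ≤⟨ sumOver-mono (C a) ψ-lower-bound ⟩
    Ψ a ∎
    where
    sq : Fin n → ℚ
    sq o = (w o - w a) * (w o - w a)

module ρ-Coefficients (ε δ : ℚ) (δ≤ε : δ ≤ ε) (ε<1 : ε < 1ℚ) where

  d e : ℚ
  d = 1ℚ - δ
  e = 1ℚ - ε

  δ<1 : δ < 1ℚ
  δ<1 = ≤-<-trans δ≤ε ε<1

  0<d : 0ℚ < d
  0<d = 0<1-x δ<1

  0<e : 0ℚ < e
  0<e = 0<1-x ε<1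

  instance
    d≢0 : NonZero d
    d≢0 = >-nonZero 0<d
    e≢0 : NonZero e
    e≢0 = >-nonZero 0<e

  P Q : ℚ
  P = (ε - δ) ÷ d
  Q = (ε - δ) ÷ e

  ρ≡ : ∀ t → ρ ε δ ε<1 δ<1 t ≡ ℕ→ℚ t * P - Q
  ρ≡ t = cong (_- Q) (*-assoc (ℕ→ℚ t) (ε - δ) (1/ d))

  ε-δ≡d-e : ε - δ ≡ d - e
  ε-δ≡d-e = sub-complements ε δ
    where
    sub-complements : ∀ ε δ → ε - δ ≡ (1ℚ - δ) - (1ℚ - ε)
    sub-complements = solve-∀ ℚ-ring

  P*d≡d-e : P * d ≡ d - e
  P*d≡d-e = trans (÷-*-cancel (ε - δ) d) ε-δ≡d-e

  Q*e≡d-e : Q * e ≡ d - e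
  Q*e≡d-e = trans (÷-*-cancel (ε - δ) e) ε-δ≡d-e

  Q*e+δ≡ε : Q * e + δ ≡ ε
  Q*e+δ≡ε = trans (cong (_+ δ) (÷-*-cancel (ε - δ) e)) (sub-add ε δ)
    where
    sub-add : ∀ ε δ → ε - δ + δ ≡ ε
    sub-add = solve-∀ ℚ-ring

  0≤Q : 0ℚ ≤ Q
  0≤Q = *-cancelʳ-≤-pos e {{positive 0<e}} (begin
    0ℚ * e  ≡⟨ *-zeroˡ e ⟩
    0ℚ      ≡⟨ +-inverseʳ δ ⟨
    δ - δ   ≤⟨ +-monoˡ-≤ (- δ) δ≤ε ⟩
    ε - δ   ≡⟨ ÷-*-cancel (ε - δ) e ⟨
    Q * e   ∎)

lemma5 : (k : ℕ) → k ≥ 1 → (n : ℕ) (G : Graph n) → ClawFree k G →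
    (w : Fin n → ℚ) (w>0 : ∀ v → 0ℚ < w v) →
    (O A : VSet n) → MaxWeightIndependent G w O → Independent G A →
    (∀ o → o ∈ O → Σ (Fin n) λ a → a ∈ Nv G o A) →
    (π : Fin n → Fin n) → IsPi G w O A π →
    let open Exchange G w O A π in
    LocallyOptimal →
    (ε δ : ℚ) → 0ℚ ≤ δ → (δ≤ε : δ ≤ ε) → (ε<1 : ε < 1ℚ) →
    (a : Fin n) → IsolatedIn-H ε a →
    ρ ε δ ε<1 (≤-<-trans δ≤ε ε<1) (card (C a)) * w a
      + δ * sumFin (λ o → if C a o then w[ w ] (Nv G o (A ─ a)) else 0ℚ)
      ≤ _÷_ (Ψ a) (w a) {{>-nonZero (w>0 a)}}
lemma5 _ _ _ G _ w w>0 O A _ _ _ π _ locallyOptimal ε δ _ δ≤ε ε<1 a isolated =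
  *≤⇒≤÷ (w>0 a) (begin
    W * (ρ ε δ ε<1 δ<1 t * W + δ * S)
      ≡⟨ cong (λ r → W * (r * W + δ * S)) (ρ≡ t) ⟩
    W * ((ℕ→ℚ t * P - Q) * W + δ * S)
      ≡⟨ expand (ℕ→ℚ t) P Q W δ S ⟩
    ℕ→ℚ t * (P * (W * W)) - Q * (W * W) + δ * (W * S)
      ≤⟨ +-monoˡ-≤ _ (+-monoˡ-≤ _ (sumOver-square-bound {P = P} {Q} 0<d 0<e P*d≡d-e Q*e≡d-e (C a) w W)) ⟩
    Sq + Q * w²[ w ] (C a) - Q * (W * W) + δ * (W * S)
      ≤⟨ +-monoˡ-≤ _ (+-monoˡ-≤ _ (+-monoʳ-≤ Sq (*-monoˡ-≤-nonNeg Q {{nonNegative 0≤Q}} w²Cₐ≤))) ⟩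
    Sq + Q * (W * W + e * W * S) - Q * (W * W) + δ * (W * S)
      ≡⟨ collect Sq Q W e S δ ⟩
    Sq + (Q * e + δ) * W * S
      ≡⟨ cong (λ z → Sq + z * W * S) Q*e+δ≡ε ⟩
    Sq + ε * W * S
      ≤⟨ Ψ-lower-bound ⟩
    Ψ a ∎)
  where
  open Exchange G w O A π
  open Isolated G w (λ v → <⇒≤ (w>0 v)) O A π ε a isolated
  open ρ-Coefficients ε δ δ≤ε ε<1

  W : ℚ
  W = w a
  t : ℕ
  t = card (C a)
  Sq : ℚ
  Sq = sumOver (C a) (λ o → (w o - W) * (w o - W))

  w²Cₐ≤ : w²[ w ] (C a) ≤ W * W + e * W * S
  w²Cₐ≤ = ≤-trans (locallyOptimal a (proj₁ isolated)) w²N⁺≤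

  expand : ∀ t P Q W δ S →
    W * ((t * P - Q) * W + δ * S) ≡ t * (P * (W * W)) - Q * (W * W) + δ * (W * S)
  expand = solve-∀ ℚ-ring
  collect : ∀ Sq Q W e S δ →
    Sq + Q * (W * W + e * W * S) - Q * (W * W) + δ * (W * S) ≡ Sq + (Q * e + δ) * W * S
  collect = solve-∀ ℚ-ring
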